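{- Let $\mathcal{A}=(A_0,A_1,\mathcal{F})$ be an algebra with $\mathcal{F}=\mathcal{G}_0\cup\mathcal{G}_1\cup\{h\}$, where: - $\mathcal{G}_0$ consists of operations on $A_0$; - $\mathcal{G}_1$ consists of operations on $A_1$; - $h:A_1\to A_0$ is a unary operation. Suppose $\vec{e}\in\Omega_0$, $\mathcal{G}_0=\varnothing$, and $\mathcal{A}_1=(A_1,\mathcal{G}_1)$ is a Ramsey algebra. Then $\mathcal{A}$ is an $\vec{e}$-Ramsey algebra.
   Context: An algebra is a pair $(\{A_\xi\}_{\xi\in I},\mathcal{F})$ with nonempty, pairwise disjoint phyla and a family $\mathcal{F}$ of operations, each with domain a finite product of phyla and codomain a phylum. An operation "on $A_i$" has all arguments and values in $A_i$. A sort is $\vec{e}\in{}^\omega I$, and $\vec{b}$ is $\vec{e}$-sorted if $\vec{b}(i)\in A_{\vec{e}(i)}$ for all $i$. Orderly terms: $\mathcal{F}_0=\mathcal{F}\cup\{\mathrm{id}_{A_\xi}\}$. $\mathcal{F}_{k+1}$ is $\mathcal{F}_k$ plus all $f$ with $f(\vec{x})=g(h_1(\vec{x}_1),\dots,h_N(\vec{x}_N))$, where $g\in\mathcal{F}$ is $N$-ary, $h_i\in\mathcal{F}_k$, and $\vec{x}_1\ast\cdots\ast\vec{x}_N=\vec{x}$ is the argument list of $f$. $\mathrm{OT}(\mathcal{F})=\bigcup_k\mathcal{F}_k$. $\vec{a}\le_\mathcal{F}\vec{b}$ means: for each $j$ there are a finite subsequence $\vec{b}_j$ of $\vec{b}$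 and $f_j\in\mathrm{OT}(\mathcal{F})$ with $\vec{a}(j)=f_j(\vec{b}_j)$, and the concatenation $\vec{b}_0\ast\vec{b}_1\ast\cdots$ is a subsequence of $\vec{b}$. $\mathrm{FR}^{\vec{e}}_\mathcal{F}(\vec{b})=\{\vec{a}(0):\vec{a}\le_\mathcal{F}\vec{b},\ \vec{a}\ \vec{e}\text{ -sorted}\}$. $\vec{e}$-Ramsey algebra: for every $\vec{e}$-sorted $\vec{b}$ and $X\subseteq A_{\vec{e}(0)}$ some $\vec{e}$-sorted $\vec{a}\le_\mathcal{F}\vec{b}$ has $\mathrm{FR}^{\vec{e}}_\mathcal{F}(\vec{a})\subseteq X$ or disjoint from $X$. For a homogeneous algebra $(A,\mathcal{G})$, $\mathrm{FR}_\mathcal{G}(\vec{b})=\{\vec{a}(0):\vec{a}\le_\mathcal{G}\vec{b}\}$. It is a Ramsey algebra if for every $\vec{b}\in{}^\omega A$ and $X\subseteq A$ some $\vec{a}\le_\mathcal{G}\vec{b}$ has $\mathrm{FR}_\mathcal{G}(\vec{a})\subseteq X$ or disjoint from $X$. $\Omega$ is the set of sorts each of whose values is taken infinitely often, and $\Omega_0=\{\vec{e}\in\Omega:\vec{e}(0)=0\}$. -}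

module Defs where

open import Data.Nat using (ℕ; zero; suc; _<_; _≤_)
open import Data.Fin using (Fin; zero; suc)
open import Data.List using (List; []; _∷_; _++_; map; replicate)
open import Data.List.Relation.Unary.All using (All; []; _∷_)
open import Data.List.Relation.Unary.All.Properties using (++⁻ˡ; ++⁻ʳ)
open import Data.List.Relation.Unary.AllPairs using (AllPairs)
open import Data.List.Membership.Propositional using (_∈_)
open import Data.Vec using (Vec; []; _∷_)
open import Data.Product using (Σ; ∃-syntax; _×_; _,_)
open import Data.Sum using (_⊎_; inj₁; inj₂)
open import Data.Unit using (⊤; tt)
open import Relation.Binary.PropositionalEquality using (_≡_)
open import Relation.Nullary using (¬_)

-- Phyla are distinct types (hence automatically "disjoint").

record Algebra (I : Set) : Set₁ where
  field
    Phy  : I → Set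
    Op   : Set
    dom  : Op → List I
    cod  : Op → I
    ⟦_⟧  : (o : Op) → All Phy (dom o) → Phy (cod o)

module _ {I : Set} (𝒜 : Algebra I) where
  open Algebra 𝒜

  -- Orderly terms OT(F): `Term xs i` is an orderly term whose argument
  -- list has sorts `xs` (each variable used once, in left-to-right
  -- order) and whose value lies in phylum i.
  --   var i          : identity id_{A_i}
  --   app g (h₁ … hN): x ↦ g(h₁(x₁),…,hN(xN)),  x = x₁ * … * xN
  mutual
    data Term : List I → I → Set where
      var : (i : I) → Term (i ∷ []) i
      app : (o : Op) {xs : List I} → Terms xs (dom o) → Term xs (cod o)

    data Terms : List I → List I → Set where
      []  : Terms [] []
      _∷_ : ∀ {xs ys i is} → Term xs i → Terms ys is → Terms (xs ++ ys) (i ∷ is)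

  mutual
    eval : ∀ {xs i} → Term xs i → All Phy xs → Phy i
    eval (var i) (x ∷ []) = x
    eval (app o ts) args = ⟦ o ⟧ (evals ts args)

    evals : ∀ {xs is} → Terms xs is → All Phy xs → All Phy is
    evals [] _ = []
    evals (_∷_ {xs} t ts) args = eval t (++⁻ˡ xs args) ∷ evals ts (++⁻ʳ xs args)

  Sort : Set
  Sort = ℕ → I

  Sorted : Sort → Set
  Sorted e = (j : ℕ) → Phy (e j)

  pick : {e : Sort} → Sorted e → (ps : List ℕ) → All Phy (map e ps)
  pick b [] = []
  pick b (p ∷ ps) = b p ∷ pick b ps

  -- a ≤_F b : a(j) = f_j(b_j), b_j the subsequence of b at positions ps j,
  -- and the concatenation b_0 * b_1 * … is a subsequence of b
  -- (positions strictly increasing within and across blocks).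
  _≤F_ : {e₁ e₂ : Sort} → Sorted e₁ → Sorted e₂ → Set
  _≤F_ {e₁} {e₂} a b =
    Σ (ℕ → List ℕ) λ ps →
    Σ ((j : ℕ) → Term (map e₂ (ps j)) (e₁ j)) λ f →
      ((j : ℕ) → a j ≡ eval (f j) (pick b (ps j)))
      × ((j : ℕ) → AllPairs _<_ (ps j))
      × ((j j′ : ℕ) → j < j′ → ∀ {x y} → x ∈ ps j → y ∈ ps j′ → x < y)

  FR : (e : Sort) {e′ : Sort} → Sorted e′ → Phy (e 0) → Set
  FR e b x = Σ (Sorted e) λ a → (a ≤F b) × (a 0 ≡ x)

  IsERamsey : Sort → Set₁
  IsERamsey e =
    (b : Sorted e) (X : Phy (e 0) → Set) →
    Σ (Sorted e) λ a → (a ≤F b) ×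
      (((x : Phy (e 0)) → FR e a x → X x) ⊎ ((x : Phy (e 0)) → FR e a x → ¬ X x))

record HomAlgebra : Set₁ where
  field
    Carrier : Set
    Op      : Set
    arity   : Op → ℕ
    ⟦_⟧     : (o : Op) → Vec Carrier (arity o) → Carrier

toVec : {I : Set} {P : I → Set} {i : I} (n : ℕ) → All P (replicate n i) → Vec (P i) n
toVec zero _ = []
toVec (suc n) (x ∷ xs) = x ∷ toVec n xs

homAsAlgebra : HomAlgebra → Algebra ⊤
homAsAlgebra H = record
  { Phy = λ _ → Carrier
  ; Op = Op
  ; dom = λ o → replicate (arity o) tt
  ; cod = λ _ → tt
  ; ⟦_⟧ = λ o args → ⟦ o ⟧ (toVec (arity o) args)
  }
  where open HomAlgebra H

IsRamseyAlgebra : HomAlgebra → Set₁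
IsRamseyAlgebra H = IsERamsey (homAsAlgebra H) (λ _ → tt)

phy2 : Set → Set → Fin 2 → Set
phy2 A₀ A₁ zero = A₀
phy2 A₀ A₁ (suc zero) = A₁

twoSorted : (A₀ : Set) (Op₀ : Set) (ar₀ : Op₀ → ℕ)
            (op₀ : (o : Op₀) → Vec A₀ (ar₀ o) → A₀)
            (𝒜₁ : HomAlgebra) (h : HomAlgebra.Carrier 𝒜₁ → A₀) → Algebra (Fin 2)
twoSorted A₀ Op₀ ar₀ op₀ 𝒜₁ h = record
  { Phy = phy2 A₀ Carrier
  ; Op = Op₀ ⊎ (Op ⊎ ⊤)
  ; dom = dm
  ; cod = cd
  ; ⟦_⟧ = sem
  }
  where
  open HomAlgebra 𝒜₁
  dm : Op₀ ⊎ (Op ⊎ ⊤) → List (Fin 2)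
  dm (inj₁ o) = replicate (ar₀ o) zero
  dm (inj₂ (inj₁ o)) = replicate (arity o) (suc zero)
  dm (inj₂ (inj₂ tt)) = suc zero ∷ []
  cd : Op₀ ⊎ (Op ⊎ ⊤) → Fin 2
  cd (inj₁ o) = zero
  cd (inj₂ (inj₁ o)) = suc zero
  cd (inj₂ (inj₂ tt)) = zero
  sem : (o : Op₀ ⊎ (Op ⊎ ⊤)) → All (phy2 A₀ Carrier) (dm o) → phy2 A₀ Carrier (cd o)
  sem (inj₁ o) args = op₀ o (toVec (ar₀ o) args)
  sem (inj₂ (inj₁ o)) args = ⟦ o ⟧ (toVec (arity o) args)
  sem (inj₂ (inj₂ tt)) (x ∷ []) = h x

InΩ : {I : Set} → (ℕ → I) → Set
InΩ {I} e = (i : I) (n : ℕ) → ∃[ m ] (n ≤ m × e m ≡ i)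

InΩ₀ : (ℕ → Fin 2) → Set
InΩ₀ e = InΩ e × e 0 ≡ zero

-- Since G₀ is empty, an orderly term of sort 1 is a G₁-term in variables of
-- sort 1, and one of sort 0 is a variable or h applied to such a term.  Let b₁
-- be the subsequence of b at the positions of sort 1, and let c ≤ b₁ be
-- homogeneous for the preimage of X under h (under the identity if e 0 = 1).
-- Putting c j at the positions of sort 1 and h (c j) at those of sort 0 gives
-- a sequence ≤ b each of whose finite reductions is the image of an element of
-- FR(c), so it inherits the homogeneity of c.
module Submission where

open import Defs
open import Data.Empty using (⊥-elim)
open import Data.Fin using (Fin; zero; suc)
open import Data.List using (List; []; _∷_; _++_; map; replicate)
open import Data.List.Extrema.Nat using (max; xs≤max)
open import Data.List.Membership.Propositional using (_∈_)
open import Data.List.Membership.Propositional.Properties using (∈-map⁻)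
open import Data.List.Properties using (++-identityʳ)
open import Data.List.Relation.Unary.All using (All; []; _∷_; lookup)
open import Data.List.Relation.Unary.All.Properties using (++⁻ˡ; ++⁻ʳ)
open import Data.List.Relation.Unary.AllPairs using (AllPairs; []; _∷_)
import Data.List.Relation.Unary.AllPairs as AllPairs
import Data.List.Relation.Unary.AllPairs.Properties as AllPairs
open import Data.List.Relation.Unary.Any using (here; there)
open import Data.Nat using (ℕ; zero; suc; _+_; _≤_; _<_; _≤′_; ≤′-refl; ≤′-step; s≤s)
open import Data.Nat.Properties using (≤⇒≤′; ≤-trans; <-trans; m≤m+n; +-monoʳ-<)
open import Data.Product using (Σ; ∃-syntax; _×_; _,_; proj₁; proj₂)
open import Data.Sum using (_⊎_; inj₁; inj₂)
import Data.Sum as Sum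
open import Data.Unit using (⊤; tt)
open import Data.Vec using (Vec; _∷_)
open import Function using (_∘_; id)
open import Relation.Binary.Core using (_Preserves_⟶_)
open import Relation.Binary.PropositionalEquality
  using (_≡_; refl; sym; trans; cong; cong₂; subst; module ≡-Reasoning)
open import Relation.Nullary using (¬_)

homogeneous-preimage : {A B : Set} {S X : A → Set} {T : B → Set} (f : B → A) →
  (∀ x → S x → ∃[ y ] (T y × x ≡ f y)) →
  ((∀ y → T y → X (f y)) ⊎ (∀ y → T y → ¬ X (f y))) →
  (∀ x → S x → X x) ⊎ (∀ x → S x → ¬ X x)
homogeneous-preimage {S = S} {X} {T} f S⊆f[T] = Sum.map inside outside
  where
  inside : (∀ y → T y → X (f y)) → ∀ x → S x → X x
  inside T⊆ x x∈S with S⊆f[T] x x∈S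
  ... | y , y∈T , refl = T⊆ y y∈T
  outside : (∀ y → T y → ¬ X (f y)) → ∀ x → S x → ¬ X x
  outside T∩ x x∈S with S⊆f[T] x x∈S
  ... | y , y∈T , refl = T∩ y y∈T

module Enumeration {P : ℕ → Set} (unbounded : ∀ n → ∃[ m ] (n ≤ m × P m)) where

  enum : ℕ → ℕ
  enum zero    = proj₁ (unbounded zero)
  enum (suc n) = proj₁ (unbounded (suc (enum n)))

  enum-P : ∀ n → P (enum n)
  enum-P zero    = proj₂ (proj₂ (unbounded zero))
  enum-P (suc n) = proj₂ (proj₂ (unbounded (suc (enum n))))

  enum-<-suc : ∀ n → enum n < enum (suc n)
  enum-<-suc n = proj₁ (proj₂ (unbounded (suc (enum n))))

  enum-strictMono : enum Preserves _<_ ⟶ _<_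
  enum-strictMono = go ∘ ≤⇒≤′
    where
    go : ∀ {m n} → suc m ≤′ n → enum m < enum n
    go {m} ≤′-refl                 = enum-<-suc m
    go {n = suc n} (≤′-step m<′n) = <-trans (go m<′n) (enum-<-suc n)

IncreasingBlocks : (ℕ → List ℕ) → Set
IncreasingBlocks ps =
  ((j : ℕ) → AllPairs _<_ (ps j)) ×
  ((j j′ : ℕ) → j < j′ → ∀ {x y} → x ∈ ps j → y ∈ ps j′ → x < y)

IncreasingBlocks-map : ∀ {σ} → σ Preserves _<_ ⟶ _<_ →
  ∀ {ps} → IncreasingBlocks ps → IncreasingBlocks (map σ ∘ ps)
IncreasingBlocks-map {σ} σ-mono {ps} (sorted , separated) =
  (λ j → AllPairs.map⁺ (AllPairs.map σ-mono (sorted j))) , separated′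
  where
  separated′ : ∀ j j′ → j < j′ → ∀ {x y} → x ∈ map σ (ps j) → y ∈ map σ (ps j′) → x < y
  separated′ j j′ j<j′ x∈ y∈ with ∈-map⁻ σ x∈ | ∈-map⁻ σ y∈
  ... | _ , x′∈ , refl | _ , y′∈ , refl = σ-mono (separated j j′ j<j′ x′∈ y′∈)

module _ {I : Set} (𝒜 : Algebra I) where
  open Algebra 𝒜 using (Phy)

  eval-subst : ∀ {xs ys i} (E : xs ≡ ys) (t : Term 𝒜 xs i) (as : All Phy ys) →
    eval 𝒜 (subst (λ zs → Term 𝒜 zs i) E t) as ≡ eval 𝒜 t (subst (All Phy) (sym E) as)
  eval-subst refl t as = refl

  eval∈FR : ∀ {i} (c : Sorted 𝒜 (λ _ → i)) {qs} → AllPairs _<_ qs →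
    (t : Term 𝒜 (map (λ _ → i) qs) i) →
    FR 𝒜 (λ _ → i) {λ _ → i} c (eval 𝒜 t (pick 𝒜 {λ _ → i} c qs))
  eval∈FR {i} c {qs} qs-sorted t = c′ , (ps , f , c′-eval , sorted , separated) , refl
    where
    -- t evaluated on c at qs, followed by the part of c beyond every position in qs
    M : ℕ
    M = suc (max 0 qs)

    c′ : Sorted 𝒜 (λ _ → i)
    c′ zero    = eval 𝒜 t (pick 𝒜 {λ _ → i} c qs)
    c′ (suc n) = c (M + n)

    ps : ℕ → List ℕ
    ps zero    = qs
    ps (suc n) = M + n ∷ []

    f : (j : ℕ) → Term 𝒜 (map (λ _ → i) (ps j)) i
    f zero    = t
    f (suc n) = var i

    c′-eval : (j : ℕ) → c′ j ≡ eval 𝒜 (f j) (pick 𝒜 {λ _ → i} c (ps j))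
    c′-eval zero    = refl
    c′-eval (suc n) = refl

    sorted : (j : ℕ) → AllPairs _<_ (ps j)
    sorted zero    = qs-sorted
    sorted (suc n) = [] ∷ []

    separated : (j j′ : ℕ) → j < j′ → ∀ {x y} → x ∈ ps j → y ∈ ps j′ → x < y
    separated zero    (suc n) _         x∈qs (here refl) =
      s≤s (≤-trans (lookup (xs≤max 0 qs) x∈qs) (m≤m+n (max 0 qs) n))
    separated (suc m) (suc n) (s≤s m<n) (here refl) (here refl) = +-monoʳ-< M m<n
    separated (suc m) (suc n) _         (here refl) (there ())
    separated (suc m) (suc n) _         (there ())  _

module _ {A : Set} {P : A → Set} where

  ++⁻ˡ-identityʳ : ∀ xs (ps : All P xs) →
    ++⁻ˡ xs (subst (All P) (sym (++-identityʳ xs)) ps) ≡ ps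
  ++⁻ˡ-identityʳ []       []       = refl
  ++⁻ˡ-identityʳ (x ∷ xs) (p ∷ ps) = begin
    ++⁻ˡ (x ∷ xs) (subst (All P) (sym (cong (x ∷_) (++-identityʳ xs))) (p ∷ ps))
      ≡⟨ cong (++⁻ˡ (x ∷ xs)) (subst-∷ (++-identityʳ xs) ps) ⟩
    p ∷ ++⁻ˡ xs (subst (All P) (sym (++-identityʳ xs)) ps)
      ≡⟨ cong (p ∷_) (++⁻ˡ-identityʳ xs ps) ⟩
    p ∷ ps ∎
    where
    open ≡-Reasoning
    subst-∷ : ∀ {ys zs} (E : ys ≡ zs) (qs : All P zs) →
      subst (All P) (sym (cong (x ∷_) E)) (p ∷ qs) ≡ p ∷ subst (All P) (sym E) qs
    subst-∷ refl qs = refl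

module _ {A B : Set} {P : A → Set} {Q : B → Set} (R : ∀ {x y} → P x → Q y → Set) where

  data Pointwise : {xs : List A} {ys : List B} → All P xs → All Q ys → Set where
    []  : Pointwise [] []
    _∷_ : ∀ {x xs y ys} {p : P x} {ps : All P xs} {q : Q y} {qs : All Q ys} →
          R p q → Pointwise ps qs → Pointwise (p ∷ ps) (q ∷ qs)

  data SplitˡView (xs₁ : List A) {xs₂} (ps : All P (xs₁ ++ xs₂)) :
       {ys : List B} → All Q ys → Set where
    split : ∀ ys₁ {ys₂} {qs : All Q (ys₁ ++ ys₂)} →
            Pointwise (++⁻ˡ xs₁ ps) (++⁻ˡ ys₁ qs) → Pointwise (++⁻ʳ xs₁ ps) (++⁻ʳ ys₁ qs) →
            SplitˡView xs₁ ps qs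

  splitˡ : ∀ xs₁ {xs₂} {ps : All P (xs₁ ++ xs₂)} {ys} {qs : All Q ys} →
           Pointwise ps qs → SplitˡView xs₁ ps qs
  splitˡ []        r        = split [] [] r
  splitˡ (x ∷ xs₁) (pq ∷ r) with splitˡ xs₁ r
  ... | split ys₁ r₁ r₂ = split (_ ∷ ys₁) (pq ∷ r₁) r₂

  data SplitʳView (ys₁ : List B) {ys₂} (qs : All Q (ys₁ ++ ys₂)) :
       {xs : List A} → All P xs → Set where
    split : ∀ xs₁ {xs₂} {ps : All P (xs₁ ++ xs₂)} →
            Pointwise (++⁻ˡ xs₁ ps) (++⁻ˡ ys₁ qs) → Pointwise (++⁻ʳ xs₁ ps) (++⁻ʳ ys₁ qs) →
            SplitʳView ys₁ qs ps

  splitʳ : ∀ ys₁ {ys₂} {qs : All Q (ys₁ ++ ys₂)} {xs} {ps : All P xs} →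
           Pointwise ps qs → SplitʳView ys₁ qs ps
  splitʳ []        r        = split [] [] r
  splitʳ (y ∷ ys₁) (pq ∷ r) with splitʳ ys₁ r
  ... | split xs₁ r₁ r₂ = split (_ ∷ xs₁) (pq ∷ r₁) r₂

  Pointwise-++⁻ˡ-[] : ∀ ys {xs} {ps : All P xs} {qs : All Q (ys ++ [])} →
                      Pointwise ps qs → Pointwise ps (++⁻ˡ ys qs)
  Pointwise-++⁻ˡ-[] []       []       = []
  Pointwise-++⁻ˡ-[] (y ∷ ys) (pq ∷ r) = pq ∷ Pointwise-++⁻ˡ-[] ys r

module TwoSorted (A₀ : Set) (𝒜₁ : HomAlgebra) (Op₀ : Set) (ar₀ : Op₀ → ℕ)
                 (op₀ : (o : Op₀) → Vec A₀ (ar₀ o) → A₀)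
                 (h : HomAlgebra.Carrier 𝒜₁ → A₀) (noOp₀ : ¬ Op₀) where
  open HomAlgebra 𝒜₁ using (Carrier; arity; ⟦_⟧)

  𝔸 : Algebra (Fin 2)
  𝔸 = twoSorted A₀ Op₀ ar₀ op₀ 𝒜₁ h

  ℍ : Algebra ⊤
  ℍ = homAsAlgebra 𝒜₁

  Ph : Fin 2 → Set
  Ph = phy2 A₀ Carrier

  one : Fin 2
  one = suc zero

  embed : (i : Fin 2) → Carrier → Ph i
  embed zero       = h
  embed (suc zero) = id

  _↦_ : {x : ⊤} {y : Fin 2} → Carrier → Ph y → Set
  _↦_ {y = y} v a = a ≡ embed y v

  _↦₁_ : {x : ⊤} {y : Fin 2} → Carrier → Ph y → Set
  _↦₁_ {y = y} v a = y ≡ one × v ↦ a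

  toVec-↦ : ∀ n {vs : All (λ _ → Carrier) (replicate n tt)} {as : All Ph (replicate n one)} →
            Pointwise _↦_ vs as → toVec n as ≡ toVec n vs
  toVec-↦ zero    []      = refl
  toVec-↦ (suc n) (p ∷ r) = cong₂ _∷_ p (toVec-↦ n r)

  mutual
    liftTerm : ∀ {xs ys} (t : Term ℍ xs tt) {vs : All (λ _ → Carrier) xs} {as : All Ph ys} →
               Pointwise _↦₁_ vs as → Σ (Term 𝔸 ys one) λ t₂ → eval ℍ t vs ↦ eval 𝔸 t₂ as
    liftTerm (var tt)   ((refl , p) ∷ []) = var one , p
    liftTerm (app o ts) r with liftTerms (arity o) ts r
    ... | ts₂ , q = app (inj₂ (inj₁ o)) ts₂ , cong ⟦ o ⟧ (toVec-↦ (arity o) q)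

    liftTerms : ∀ n {xs ys} (ts : Terms ℍ xs (replicate n tt))
                {vs : All (λ _ → Carrier) xs} {as : All Ph ys} → Pointwise _↦₁_ vs as →
                Σ (Terms 𝔸 ys (replicate n one)) λ ts₂ →
                  Pointwise _↦_ (evals ℍ ts vs) (evals 𝔸 ts₂ as)
    liftTerms zero    []               [] = [] , []
    liftTerms (suc n) (_∷_ {xs₁} t ts) r  with splitˡ _↦₁_ xs₁ r
    ... | split ys₁ r₁ r₂ with liftTerm t r₁ | liftTerms n ts r₂
    ... | t₂ , p | ts₂ , q = t₂ ∷ ts₂ , p ∷ q

  mutual
    lowerTerm : ∀ {zs i xs} (t : Term 𝔸 zs i) {vs : All (λ _ → Carrier) xs} {as : All Ph zs} →
                Pointwise _↦_ vs as → Σ (Term ℍ xs tt) λ t′ → eval ℍ t′ vs ↦ eval 𝔸 t as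
    lowerTerm (var i)                (p ∷ []) = var tt , p
    lowerTerm (app (inj₁ o) _)       _        = ⊥-elim (noOp₀ o)
    lowerTerm (app (inj₂ (inj₁ o)) ts) r with lowerTerms (arity o) ts r
    ... | ts′ , q = app o ts′ , cong ⟦ o ⟧ (toVec-↦ (arity o) q)
    lowerTerm (app (inj₂ (inj₂ tt)) (_∷_ {zs} t [])) r
      with lowerTerm t (Pointwise-++⁻ˡ-[] _↦_ zs r)
    ... | t′ , p = t′ , cong h p

    lowerTerms : ∀ n {zs xs} (ts : Terms 𝔸 zs (replicate n one))
                 {vs : All (λ _ → Carrier) xs} {as : All Ph zs} → Pointwise _↦_ vs as →
                 Σ (Terms ℍ xs (replicate n tt)) λ ts′ →
                   Pointwise _↦_ (evals ℍ ts′ vs) (evals 𝔸 ts as)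
    lowerTerms zero    []               [] = [] , []
    lowerTerms (suc n) (_∷_ {zs₁} t ts) r  with splitʳ _↦_ zs₁ r
    ... | split xs₁ r₁ r₂ with lowerTerm t r₁ | lowerTerms n ts r₂
    ... | t′ , p | ts′ , q = t′ ∷ ts′ , p ∷ q

  -- h applied to t is indexed by ys ++ [], which is not definitionally ys.
  applyH : ∀ {ys} → Term 𝔸 ys one → Term 𝔸 ys zero
  applyH {ys} t =
    subst (λ zs → Term 𝔸 zs zero) (++-identityʳ ys) (app (inj₂ (inj₂ tt)) (t ∷ []))

  eval-applyH : ∀ {ys} (t : Term 𝔸 ys one) (as : All Ph ys) →
                eval 𝔸 (applyH t) as ≡ h (eval 𝔸 t as)
  eval-applyH {ys} t as = begin
    eval 𝔸 (applyH t) as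
      ≡⟨ eval-subst 𝔸 (++-identityʳ ys) _ as ⟩
    h (eval 𝔸 t (++⁻ˡ ys (subst (All Ph) (sym (++-identityʳ ys)) as)))
      ≡⟨ cong (h ∘ eval 𝔸 t) (++⁻ˡ-identityʳ ys as) ⟩
    h (eval 𝔸 t as) ∎
    where open ≡-Reasoning

  liftTermAt : ∀ i {xs ys} (t : Term ℍ xs tt) {vs : All (λ _ → Carrier) xs} {as : All Ph ys} →
               Pointwise _↦₁_ vs as → Σ (Term 𝔸 ys i) λ t₂ → eval ℍ t vs ↦ eval 𝔸 t₂ as
  liftTermAt (suc zero) t r = liftTerm t r
  liftTermAt zero       t {as = as} r with liftTerm t r
  ... | t₂ , p = applyH t₂ , trans (eval-applyH t₂ as) (cong h p)

  module _ (e : Sort 𝔸) where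

    embedded : (ℕ → Carrier) → Sorted 𝔸 e
    embedded c j = embed (e j) (c j)

    pick-embedded : (c : ℕ → Carrier) (qs : List ℕ) →
                    Pointwise _↦_ (pick ℍ {λ _ → tt} c qs) (pick 𝔸 {e} (embedded c) qs)
    pick-embedded c []       = []
    pick-embedded c (q ∷ qs) = refl ∷ pick-embedded c qs

    FR-embedded : (c : ℕ → Carrier) → ∀ x → FR 𝔸 e {e} (embedded c) x →
                  ∃[ y ] (FR ℍ (λ _ → tt) {λ _ → tt} c y × x ≡ embed (e 0) y)
    FR-embedded c x (_ , (ps , f , eqs , sorted , _) , refl)
      with lowerTerm (f 0) (pick-embedded c (ps 0))
    ... | t′ , p = _ , eval∈FR ℍ c (sorted 0) t′ , trans (eqs 0) p

    module _ (b : Sorted 𝔸 e) {σ : ℕ → ℕ} (σ-mono : σ Preserves _<_ ⟶ _<_)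
             (σ-one : ∀ n → e (σ n) ≡ one) where

      subsequence : ℕ → Carrier
      subsequence n = subst Ph (σ-one n) (b (σ n))

      pick-subsequence : ∀ qs →
        Pointwise _↦₁_ (pick ℍ {λ _ → tt} subsequence qs) (pick 𝔸 {e} b (map σ qs))
      pick-subsequence []       = []
      pick-subsequence (q ∷ qs) =
        (σ-one q , embed-subst (σ-one q) (b (σ q))) ∷ pick-subsequence qs
        where
        embed-subst : ∀ {i} (E : i ≡ one) (a : Ph i) → a ≡ embed i (subst Ph E a)
        embed-subst refl a = refl

      embedded-≤F : ∀ {c} → _≤F_ ℍ {λ _ → tt} {λ _ → tt} c subsequence →
                    _≤F_ 𝔸 {e} {e} (embedded c) b
      embedded-≤F {c} (ps , f , eqs , blocks) =
        map σ ∘ ps , proj₁ ∘ lifted , eqs′ , IncreasingBlocks-map σ-mono blocks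
        where
        lifted : ∀ j → Σ (Term 𝔸 (map e (map σ (ps j))) (e j)) λ t₂ →
                   eval ℍ (f j) (pick ℍ {λ _ → tt} subsequence (ps j))
                     ↦ eval 𝔸 t₂ (pick 𝔸 {e} b (map σ (ps j)))
        lifted j = liftTermAt (e j) (f j) (pick-subsequence (ps j))
        eqs′ : ∀ j → embedded c j ≡ eval 𝔸 (proj₁ (lifted j)) (pick 𝔸 {e} b (map σ (ps j)))
        eqs′ j = trans (cong (embed (e j)) (eqs j)) (sym (proj₂ (lifted j)))

mainTheorem4 : (A₀ : Set) (𝒜₁ : HomAlgebra)
    → A₀ → HomAlgebra.Carrier 𝒜₁
    → (Op₀ : Set) (ar₀ : Op₀ → ℕ) (op₀ : (o : Op₀) → Vec A₀ (ar₀ o) → A₀)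
    → (h : HomAlgebra.Carrier 𝒜₁ → A₀)
    → (e : ℕ → Fin 2) → InΩ₀ e
    → ¬ Op₀
    → IsRamseyAlgebra 𝒜₁
    → IsERamsey (twoSorted A₀ Op₀ ar₀ op₀ 𝒜₁ h) e
mainTheorem4 A₀ 𝒜₁ _ _ Op₀ ar₀ op₀ h e (often , _) noOp₀ ramsey b X =
  let c , c≤b₁ , homogeneous = ramsey b₁ (X ∘ embed (e 0)) in
  embedded e c ,
  embedded-≤F e b enum-strictMono enum-P c≤b₁ ,
  homogeneous-preimage (embed (e 0)) (FR-embedded e c) homogeneous
  where
  open TwoSorted A₀ 𝒜₁ Op₀ ar₀ op₀ h noOp₀
  open Enumeration (often one)
  b₁ : ℕ → HomAlgebra.Carrier 𝒜₁
  b₁ = subsequence e b enum-strictMono enum-P
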